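{- Let $q\ge 2$ be an integer and let $A$ be an alphabet with $q$ letters. For $n\in\mathbb{N}$ let $R_n$ denote the number of rich words of length $n$ over $A$. Then $\lim_{n\to\infty}\sqrt[n]{R_n}=1$.
   Context: A finite word $u=u_1\cdots u_n$ over $A$ is a palindrome if $u_1u_2\cdots u_n=u_nu_{n-1}\cdots u_1$; the empty word is a palindrome and a factor of every word. A word $w$ of length $n$ is called rich if it has exactly $n+1$ distinct palindromic factors (including the empty word); every word of length $n$ has at most $n+1$ distinct palindromic factors. -}

module Defs where

open import Data.Nat using (ℕ; zero; suc; _≟_)
open import Data.Fin using (Fin)
import Data.Fin as Fin
open import Data.List using (List; []; _∷_; [_]; map; concatMap; inits; tails; filter; deduplicate; reverse; length; allFin)
open import Data.List.Properties using (≡-dec)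
open import Relation.Binary.PropositionalEquality using (_≡_)

Word : ℕ → Set
Word q = List (Fin q)

words : (q n : ℕ) → List (Word q)
words q zero = [ [] ]
words q (suc n) = concatMap (λ a → map (a ∷_) (words q n)) (allFin q)

factors : {q : ℕ} → Word q → List (Word q)
factors w = concatMap inits (tails w)

IsPalindrome : {q : ℕ} → Word q → Set
IsPalindrome u = reverse u ≡ u

-- The list of distinct palindromic factors of w (empty word included).
palFactors : {q : ℕ} → Word q → List (Word q)
palFactors w =
  deduplicate (≡-dec Fin._≟_)
    (filter (λ u → ≡-dec Fin._≟_ (reverse u) u) (factors w))

IsRich : {q : ℕ} → Word q → Set
IsRich w = length (palFactors w) ≡ suc (length w)

richCount : (q n : ℕ) → ℕ
richCount q n = length (filter (λ w → length (palFactors w) ≟ suc (length w)) (words q n))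

-- Every nonempty rich word a w has a unique palindromic prefix p that does not occur in w,
-- and the rest of the word after p is again rich. Cutting off such prefixes repeatedly factors
-- a rich word into palindromes. A long palindrome (length > L) is determined by its right half,
-- a rich word of about half the length; the short ones are pairwise distinct, so there are
-- boundedly many of them. Hence R_n = O(r^(2n)) implies R_n = O((r (1 + 1/M))^n) once L is
-- large compared with M. Iterating this from R_n ≤ q^n < (1 + 1/M)^((qM + 1) n) brings the
-- exponent of 1 + 1/M down to 3, and for M large (1 + 1/M)^3 < 1 + 1/(k + 1).

module Submission where

open import Defs
open import Data.Nat using (ℕ; zero; suc; _+_; _*_; _∸_; _^_; _≤_; _<_; z≤n; s≤s; ⌊_/2⌋; ⌈_/2⌉; NonZero; >-nonZero)
open import Data.Nat.Properties
open import Data.Nat.Induction using (<-rec)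
open import Data.Nat.Tactic.RingSolver using (solve-∀)
open import Data.Fin using (Fin)
import Data.Fin as Fin
open import Data.List
  using (List; []; _∷_; [_]; _++_; map; concatMap; inits; tails; filter; reverse; length; take; drop; replicate; allFin;
         cartesianProductWith)
open import Data.List.Properties
open import Data.List.Membership.Propositional using (_∈_; _∉_; find; lose)
open import Data.List.Membership.Propositional.Properties
open import Data.List.Relation.Binary.Subset.Propositional using (_⊆_)
open import Data.List.Relation.Unary.Any using (here; there)
import Data.List.Relation.Unary.All as All
open import Data.List.Relation.Unary.All.Properties using (¬All⇒Any¬)
open import Data.List.Relation.Unary.AllPairs using ([]; _∷_)
open import Data.List.Relation.Unary.Unique.Propositional using (Unique)
import Data.List.Relation.Unary.Unique.Propositional.Properties as Unique
open import Data.List.Relation.Unary.Unique.DecPropositional.Properties using (deduplicate-!)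
import Data.List.Membership.DecPropositional as DecMembership
open import Data.Product using (∃-syntax; _×_; _,_; proj₁; proj₂)
open import Data.Sum using (_⊎_; inj₁; inj₂)
open import Data.Empty using (⊥-elim)
open import Relation.Nullary using (¬_; Dec; yes; no)
open import Relation.Binary.Definitions using (DecidableEquality)
open import Relation.Binary.PropositionalEquality hiding ([_])

module _ {A : Set} where

  private
    ∈-++-∷⇒∈-++ : ∀ {z x : A} ys zs → z ∈ ys ++ x ∷ zs → z ≢ x → z ∈ ys ++ zs
    ∈-++-∷⇒∈-++ []       zs (here refl) z≢x = ⊥-elim (z≢x refl)
    ∈-++-∷⇒∈-++ []       zs (there z∈)  z≢x = z∈
    ∈-++-∷⇒∈-++ (y ∷ ys) zs (here refl) z≢x = here refl
    ∈-++-∷⇒∈-++ (y ∷ ys) zs (there z∈)  z≢x = there (∈-++-∷⇒∈-++ ys zs z∈ z≢x)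

  Unique-⊆⇒length≤ : {xs ys : List A} → Unique xs → xs ⊆ ys → length xs ≤ length ys
  Unique-⊆⇒length≤ {[]}     _            _     = z≤n
  Unique-⊆⇒length≤ {x ∷ xs} (x∉xs ∷ xs!) xs⊆ys with ∈-∃++ (xs⊆ys (here refl))
  ... | ys , zs , refl = begin
    suc (length xs)             ≤⟨ s≤s (Unique-⊆⇒length≤ xs! xs⊆ys++zs) ⟩
    suc (length (ys ++ zs))     ≡⟨ cong suc (length-++ ys) ⟩
    suc (length ys + length zs) ≡⟨ +-suc (length ys) (length zs) ⟨
    length ys + length (x ∷ zs) ≡⟨ length-++ ys ⟨
    length (ys ++ x ∷ zs)       ∎
    where
    open ≤-Reasoning
    xs⊆ys++zs : xs ⊆ ys ++ zs
    xs⊆ys++zs v∈xs = ∈-++-∷⇒∈-++ ys zs (xs⊆ys (there v∈xs)) (λ { refl → All.lookup x∉xs v∈xs refl })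

  Unique-⊆-∉⇒length< : {xs ys : List A} {z : A} → Unique xs → xs ⊆ ys → z ∈ ys → z ∉ xs →
                        length xs < length ys
  Unique-⊆-∉⇒length< {xs} xs! xs⊆ys z∈ys z∉xs =
    Unique-⊆⇒length≤ (All.tabulate (λ { v∈xs refl → z∉xs v∈xs }) ∷ xs!) λ where
      (here refl) → z∈ys
      (there v∈xs) → xs⊆ys v∈xs

  ∈-inits⁻ : ∀ (w : List A) {u} → u ∈ inits w → ∃[ y ] u ++ y ≡ w
  ∈-inits⁻ []      (here refl) = [] , refl
  ∈-inits⁻ (a ∷ w) (here refl) = a ∷ w , refl
  ∈-inits⁻ (a ∷ w) (there u∈) with ∈-map⁻ (a ∷_) u∈
  ... | u , u∈inits , refl with ∈-inits⁻ w u∈inits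
  ...   | y , refl = y , refl

  ∈-inits⁺ : ∀ (u y : List A) → u ∈ inits (u ++ y)
  ∈-inits⁺ []      y = here refl
  ∈-inits⁺ (a ∷ u) y = there (∈-map⁺ (a ∷_) (∈-inits⁺ u y))

  ∈-tails⁻ : ∀ (w : List A) {t} → t ∈ tails w → ∃[ x ] x ++ t ≡ w
  ∈-tails⁻ []      (here refl) = [] , refl
  ∈-tails⁻ (a ∷ w) (here refl) = [] , refl
  ∈-tails⁻ (a ∷ w) (there t∈) with ∈-tails⁻ w t∈
  ... | x , refl = a ∷ x , refl

  ∈-tails⁺ : ∀ (x t : List A) → t ∈ tails (x ++ t)
  ∈-tails⁺ []      []      = here refl
  ∈-tails⁺ []      (a ∷ t) = here refl
  ∈-tails⁺ (a ∷ x) t       = there (∈-tails⁺ x t)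

  ++-prefix-≤ : ∀ (u v y z : List A) → u ++ y ≡ v ++ z → length u ≤ length v → ∃[ t ] v ≡ u ++ t
  ++-prefix-≤ []      v       y z eq le       = v , refl
  ++-prefix-≤ (b ∷ u) (c ∷ v) y z eq (s≤s le) with ∷-injective eq
  ... | refl , eq′ with ++-prefix-≤ u v y z eq′ le
  ...   | t , refl = t , refl

  reverse-∷ : ∀ (b : A) t → ∃[ c ] ∃[ r ] reverse (b ∷ t) ≡ c ∷ r
  reverse-∷ b t with reverse t | unfold-reverse b t
  ... | []    | eq = b , [] , eq
  ... | c ∷ r | eq = c , r ++ [ b ] , eq

  take-++-≤ : ∀ k (xs ys : List A) → k ≤ length xs → take k (xs ++ ys) ≡ take k xs
  take-++-≤ zero    xs       ys _        = refl
  take-++-≤ (suc k) (x ∷ xs) ys (s≤s k≤) = cong (x ∷_) (take-++-≤ k xs ys k≤)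

  replicate-++-[] : ∀ n (a : A) → replicate n a ++ [ a ] ≡ a ∷ replicate n a
  replicate-++-[] zero    a = refl
  replicate-++-[] (suc n) a = cong (a ∷_) (replicate-++-[] n a)

module _ {A : Set} (_≟ᴬ_ : DecidableEquality A) where
  open DecMembership _≟ᴬ_ using (_∈?_)

  ⊆⊎∃∉ : (xs ys : List A) → ys ⊆ xs ⊎ ∃[ z ] (z ∈ ys × z ∉ xs)
  ⊆⊎∃∉ xs ys with All.all? (_∈? xs) ys
  ... | yes ys⊆xs = inj₁ (All.lookup ys⊆xs)
  ... | no  ys⊈xs = inj₂ (find (¬All⇒Any¬ (_∈? xs) ys ys⊈xs))

  Unique-⊆-but-one⇒length≤ : (xs : List A) {ys : List A} → Unique ys →
    (∀ {u v} → u ∈ ys → u ∉ xs → v ∈ ys → v ∉ xs → u ≡ v) → length ys ≤ suc (length xs)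
  Unique-⊆-but-one⇒length≤ xs {ys} ys! atMostOne with ⊆⊎∃∉ xs ys
  ... | inj₁ ys⊆xs = m≤n⇒m≤1+n (Unique-⊆⇒length≤ ys! ys⊆xs)
  ... | inj₂ (z , z∈ys , z∉xs) = Unique-⊆⇒length≤ ys! ys⊆z∷xs
    where
    ys⊆z∷xs : ys ⊆ z ∷ xs
    ys⊆z∷xs {v} v∈ys with v ∈? xs
    ... | yes v∈xs = there v∈xs
    ... | no  v∉xs = here (atMostOne v∈ys v∉xs z∈ys z∉xs)

-- Palindromic factors and rich words

module Palindromes {q : ℕ} where

  Factor : Word q → Word q → Set
  Factor u w = ∃[ x ] ∃[ y ] x ++ u ++ y ≡ w

  Prefix : Word q → Word q → Set
  Prefix u w = ∃[ y ] u ++ y ≡ w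

  _≟ʷ_ : DecidableEquality (Word q)
  _≟ʷ_ = ≡-dec Fin._≟_

  palindrome? : (u : Word q) → Dec (IsPalindrome u)
  palindrome? u = reverse u ≟ʷ u

  Factor-[] : ∀ w → Factor [] w
  Factor-[] w = [] , w , refl

  Factor-prepend : ∀ {u w} p → Factor u w → Factor u (p ++ w)
  Factor-prepend {u} p (x , y , refl) = p ++ x , y , ++-assoc p x (u ++ y)

  Factor-∷⁻ : ∀ {u w} a → Factor u (a ∷ w) → Prefix u (a ∷ w) ⊎ Factor u w
  Factor-∷⁻ a ([]    , y , eq) = inj₁ (y , eq)
  Factor-∷⁻ a (b ∷ x , y , eq) = inj₂ (x , y , ∷-injectiveʳ eq)

  Factor⇒length≤ : ∀ {u w} → Factor u w → length u ≤ length w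
  Factor⇒length≤ {u} (x , y , refl) = begin
    length u                         ≤⟨ m≤m+n (length u) (length y) ⟩
    length u + length y              ≤⟨ m≤n+m (length u + length y) (length x) ⟩
    length x + (length u + length y) ≡⟨ cong (length x +_) (length-++ u) ⟨
    length x + length (u ++ y)       ≡⟨ length-++ x ⟨
    length (x ++ u ++ y)             ∎
    where open ≤-Reasoning

  Factor-reverse : ∀ {u w} → Factor u w → Factor (reverse u) (reverse w)
  Factor-reverse {u} (x , y , refl) = reverse y , reverse x , sym (begin
    reverse (x ++ u ++ y)                 ≡⟨ reverse-++ x (u ++ y) ⟩
    reverse (u ++ y) ++ reverse x         ≡⟨ cong (_++ reverse x) (reverse-++ u y) ⟩
    (reverse y ++ reverse u) ++ reverse x ≡⟨ ++-assoc (reverse y) (reverse u) (reverse x) ⟩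
    reverse y ++ reverse u ++ reverse x   ∎)
    where open ≡-Reasoning

  Factor-palindrome-reverse : ∀ {u w} → IsPalindrome u → Factor u w → Factor u (reverse w)
  Factor-palindrome-reverse u-pal f = subst (λ v → Factor v _) u-pal (Factor-reverse f)

  ∈-factors⁻ : ∀ w {u} → u ∈ factors w → Factor u w
  ∈-factors⁻ w u∈ with find (∈-concatMap⁻ inits {xs = tails w} u∈)
  ... | t , t∈ , u∈inits with ∈-tails⁻ w t∈ | ∈-inits⁻ t u∈inits
  ...   | x , refl | y , refl = x , y , refl

  ∈-factors⁺ : ∀ {u w} → Factor u w → u ∈ factors w
  ∈-factors⁺ {u} (x , y , refl) =
    ∈-concatMap⁺ inits {xs = tails (x ++ u ++ y)} (lose (∈-tails⁺ x (u ++ y)) (∈-inits⁺ u y))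

  ∈-palFactors⁻ : ∀ w {u} → u ∈ palFactors w → Factor u w × IsPalindrome u
  ∈-palFactors⁻ w u∈ with ∈-filter⁻ palindrome? {xs = factors w} (∈-deduplicate⁻ _≟ʷ_ _ u∈)
  ... | u∈factors , u-pal = ∈-factors⁻ w u∈factors , u-pal

  ∈-palFactors⁺ : ∀ {u w} → Factor u w → IsPalindrome u → u ∈ palFactors w
  ∈-palFactors⁺ f u-pal = ∈-deduplicate⁺ _≟ʷ_ (∈-filter⁺ palindrome? (∈-factors⁺ f) u-pal)

  palFactors-unique : ∀ w → Unique (palFactors w)
  palFactors-unique w = deduplicate-! _≟ʷ_ (filter palindrome? (factors w))

  palFactors-prepend : ∀ p w → palFactors w ⊆ palFactors (p ++ w)
  palFactors-prepend p w u∈ with ∈-palFactors⁻ w u∈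
  ... | f , u-pal = ∈-palFactors⁺ (Factor-prepend p f) u-pal

  NewPalPrefix : Word q → Fin q → Word q → Set
  NewPalPrefix p a w = Prefix p (a ∷ w) × IsPalindrome p × ¬ Factor p w

  ∈-palFactors-∷-∉⇒NewPalPrefix : ∀ a w {u} → u ∈ palFactors (a ∷ w) → u ∉ palFactors w → NewPalPrefix u a w
  ∈-palFactors-∷-∉⇒NewPalPrefix a w u∈ u∉ with ∈-palFactors⁻ (a ∷ w) u∈
  ... | f , u-pal with Factor-∷⁻ a f
  ...   | inj₁ prefix = prefix , u-pal , λ f′ → u∉ (∈-palFactors⁺ f′ u-pal)
  ...   | inj₂ f′     = ⊥-elim (u∉ (∈-palFactors⁺ f′ u-pal))

  -- A proper palindromic prefix u of a palindrome v is also a suffix of v, so it recurs after the first letter.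
  NewPalPrefix-shortest : ∀ {u v a w} → NewPalPrefix u a w → Prefix v (a ∷ w) → IsPalindrome v →
                          length u ≤ length v → u ≡ v
  NewPalPrefix-shortest {u} {v} {a} {w} ((y , u++y≡) , u-pal , u∉w) (z , v++z≡) v-pal |u|≤|v|
    with ++-prefix-≤ u v y z (trans u++y≡ (sym v++z≡)) |u|≤|v|
  ... | []    , refl = sym (++-identityʳ u)
  ... | b ∷ t , refl with reverse-∷ b t
  ...   | c , r , rev≡ = ⊥-elim (u∉w (r , z , ∷-injectiveʳ c∷r++u++z≡))
    where
    u++b∷t≡ : u ++ b ∷ t ≡ c ∷ r ++ u
    u++b∷t≡ = trans (sym v-pal) (trans (reverse-++ u (b ∷ t)) (cong₂ _++_ rev≡ u-pal))
    c∷r++u++z≡ : c ∷ r ++ u ++ z ≡ a ∷ w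
    c∷r++u++z≡ = trans (sym (++-assoc (c ∷ r) u z)) (trans (cong (_++ z) (sym u++b∷t≡)) v++z≡)

  NewPalPrefix-unique : ∀ {u v a w} → NewPalPrefix u a w → NewPalPrefix v a w → u ≡ v
  NewPalPrefix-unique {u} {v} new-u@(pre-u , pal-u , _) new-v@(pre-v , pal-v , _)
    with ≤-total (length u) (length v)
  ... | inj₁ |u|≤|v| = NewPalPrefix-shortest new-u pre-v pal-v |u|≤|v|
  ... | inj₂ |v|≤|u| = sym (NewPalPrefix-shortest new-v pre-u pal-u |v|≤|u|)

  palFactors-∷-≤ : ∀ a w → length (palFactors (a ∷ w)) ≤ suc (length (palFactors w))
  palFactors-∷-≤ a w = Unique-⊆-but-one⇒length≤ _≟ʷ_ (palFactors w) (palFactors-unique (a ∷ w))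
    λ u∈ u∉ v∈ v∉ → NewPalPrefix-unique (∈-palFactors-∷-∉⇒NewPalPrefix a w u∈ u∉)
                                        (∈-palFactors-∷-∉⇒NewPalPrefix a w v∈ v∉)

  palFactors-length≤ : ∀ w → length (palFactors w) ≤ suc (length w)
  palFactors-length≤ []      = s≤s z≤n
  palFactors-length≤ (a ∷ w) = ≤-trans (palFactors-∷-≤ a w) (s≤s (palFactors-length≤ w))

  IsRich-∷⁻ : ∀ a w → IsRich (a ∷ w) → IsRich w
  IsRich-∷⁻ a w rich = ≤-antisym (palFactors-length≤ w)
    (≤-pred (subst (_≤ suc (length (palFactors w))) rich (palFactors-∷-≤ a w)))

  IsRich-∷⇒NewPalPrefix : ∀ a w → IsRich (a ∷ w) → ∃[ p ] NewPalPrefix p a w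
  IsRich-∷⇒NewPalPrefix a w rich with ⊆⊎∃∉ _≟ʷ_ (palFactors w) (palFactors (a ∷ w))
  ... | inj₁ ⊆w = ⊥-elim (1+n≰n (begin
        suc (suc (length w))        ≡⟨ rich ⟨
        length (palFactors (a ∷ w)) ≤⟨ Unique-⊆⇒length≤ (palFactors-unique (a ∷ w)) ⊆w ⟩
        length (palFactors w)       ≤⟨ palFactors-length≤ w ⟩
        suc (length w)              ∎))
    where open ≤-Reasoning
  ... | inj₂ (p , p∈ , p∉) = p , ∈-palFactors-∷-∉⇒NewPalPrefix a w p∈ p∉

  NewPalPrefix⇒IsRich-∷ : ∀ {p a w} → IsRich w → NewPalPrefix p a w → IsRich (a ∷ w)
  NewPalPrefix⇒IsRich-∷ {p} {a} {w} rich (pre , p-pal , p∉w) = ≤-antisym (palFactors-length≤ (a ∷ w))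
    (subst (_< length (palFactors (a ∷ w))) rich
      (Unique-⊆-∉⇒length< (palFactors-unique w) (palFactors-prepend [ a ] w)
        (∈-palFactors⁺ ([] , pre) p-pal) (λ p∈ → p∉w (proj₁ (∈-palFactors⁻ w p∈)))))

  palFactors-reverse-≤ : ∀ w → length (palFactors w) ≤ length (palFactors (reverse w))
  palFactors-reverse-≤ w = Unique-⊆⇒length≤ (palFactors-unique w) λ u∈ →
    let f , u-pal = ∈-palFactors⁻ w u∈ in ∈-palFactors⁺ (Factor-palindrome-reverse u-pal f) u-pal

  palFactors-reverse : ∀ w → length (palFactors (reverse w)) ≡ length (palFactors w)
  palFactors-reverse w = ≤-antisym
    (≤-trans (palFactors-reverse-≤ (reverse w))
             (≤-reflexive (cong (λ v → length (palFactors v)) (reverse-involutive w))))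
    (palFactors-reverse-≤ w)

  IsRich-reverse : ∀ w → IsRich w → IsRich (reverse w)
  IsRich-reverse w rich = trans (palFactors-reverse w) (trans rich (cong suc (sym (length-reverse w))))

  IsRich-++⁻ʳ : ∀ x y → IsRich (x ++ y) → IsRich y
  IsRich-++⁻ʳ []      y rich = rich
  IsRich-++⁻ʳ (a ∷ x) y rich = IsRich-++⁻ʳ x y (IsRich-∷⁻ a (x ++ y) rich)

  IsRich-++⁻ˡ : ∀ x y → IsRich (x ++ y) → IsRich x
  IsRich-++⁻ˡ x y rich = subst IsRich (reverse-involutive x) (IsRich-reverse (reverse x)
    (IsRich-++⁻ʳ (reverse y) (reverse x) (subst IsRich (reverse-++ x y) (IsRich-reverse (x ++ y) rich))))

-- Covering the rich words by lists of candidates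

module _ {A B C : Set} (f : A → B → C) where

  concatMap-map≡cartesianProductWith : ∀ xs ys →
    concatMap (λ x → map (f x) ys) xs ≡ cartesianProductWith f xs ys
  concatMap-map≡cartesianProductWith []       ys = refl
  concatMap-map≡cartesianProductWith (x ∷ xs) ys =
    cong (map (f x) ys ++_) (concatMap-map≡cartesianProductWith xs ys)

  length-cartesianProductWith : ∀ xs ys → length (cartesianProductWith f xs ys) ≡ length xs * length ys
  length-cartesianProductWith []       ys = refl
  length-cartesianProductWith (x ∷ xs) ys = begin
    length (map (f x) ys ++ cartesianProductWith f xs ys)
      ≡⟨ length-++ (map (f x) ys) ⟩
    length (map (f x) ys) + length (cartesianProductWith f xs ys)
      ≡⟨ cong₂ _+_ (length-map (f x) ys) (length-cartesianProductWith xs ys) ⟩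
    length ys + length xs * length ys ∎
    where open ≡-Reasoning

words-suc : ∀ q n → words q (suc n) ≡ cartesianProductWith _∷_ (allFin q) (words q n)
words-suc q n = concatMap-map≡cartesianProductWith _∷_ (allFin q) (words q n)

∈-words : ∀ {q} (w : Word q) → w ∈ words q (length w)
∈-words         []      = here refl
∈-words {q} (a ∷ w) rewrite words-suc q (length w) =
  ∈-cartesianProductWith⁺ _∷_ (∈-allFin a) (∈-words w)

∈-words⁻ : ∀ {q} n {w : Word q} → w ∈ words q n → length w ≡ n
∈-words⁻         zero    (here refl) = refl
∈-words⁻ {q} (suc n) w∈ rewrite words-suc q n
  with ∈-cartesianProductWith⁻ _∷_ (allFin q) (words q n) w∈
... | a , w , _ , w∈words , refl = cong suc (∈-words⁻ n w∈words)

words-unique : ∀ q n → Unique (words q n)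
words-unique q zero    = All.[] ∷ []
words-unique q (suc n) rewrite words-suc q n =
  Unique.cartesianProductWith⁺ _∷_ ∷-injective (Unique.allFin⁺ q) (words-unique q n)

length-words : ∀ q n → length (words q n) ≡ q ^ n
length-words q zero    = refl
length-words q (suc n) = begin
  length (words q (suc n))
    ≡⟨ cong length (words-suc q n) ⟩
  length (cartesianProductWith _∷_ (allFin q) (words q n))
    ≡⟨ length-cartesianProductWith _∷_ (allFin q) (words q n) ⟩
  length (allFin q) * length (words q n)
    ≡⟨ cong₂ _*_ (length-tabulate {n = q} (λ i → i)) (length-words q n) ⟩
  q * q ^ n ∎
  where open ≡-Reasoning

rich? : ∀ {q} (w : Word q) → Dec (IsRich w)
rich? w = length (palFactors w) ≟ suc (length w)

richWords : ∀ q n → List (Word q)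
richWords q n = filter rich? (words q n)

∈-richWords : ∀ {q} {w : Word q} → IsRich w → w ∈ richWords q (length w)
∈-richWords rich = ∈-filter⁺ rich? (∈-words _) rich

n≤⌈n/2⌉+⌈n/2⌉ : ∀ n → n ≤ ⌈ n /2⌉ + ⌈ n /2⌉
n≤⌈n/2⌉+⌈n/2⌉ n = begin
  n                   ≡⟨ ⌊n/2⌋+⌈n/2⌉≡n n ⟨
  ⌊ n /2⌋ + ⌈ n /2⌉   ≤⟨ +-monoˡ-≤ ⌈ n /2⌉ (⌊n/2⌋≤⌈n/2⌉ n) ⟩
  ⌈ n /2⌉ + ⌈ n /2⌉   ∎
  where open ≤-Reasoning

⌈n/2⌉+⌈n/2⌉≤1+n : ∀ n → ⌈ n /2⌉ + ⌈ n /2⌉ ≤ suc n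
⌈n/2⌉+⌈n/2⌉≤1+n n = begin
  ⌊ suc n /2⌋ + ⌊ suc n /2⌋ ≤⟨ +-monoʳ-≤ ⌊ suc n /2⌋ (⌊n/2⌋≤⌈n/2⌉ (suc n)) ⟩
  ⌊ suc n /2⌋ + ⌈ suc n /2⌉ ≡⟨ ⌊n/2⌋+⌈n/2⌉≡n (suc n) ⟩
  suc n                     ∎
  where open ≤-Reasoning

module Halves {q : ℕ} where
  open Palindromes {q}

  rightHalf : Word q → Word q
  rightHalf p = drop ⌊ length p /2⌋ p

  length-rightHalf : ∀ p → length (rightHalf p) ≡ ⌈ length p /2⌉
  length-rightHalf p = begin
    length (drop k p)                 ≡⟨ length-drop k p ⟩
    length p ∸ k                      ≡⟨ cong (_∸ k) (⌊n/2⌋+⌈n/2⌉≡n (length p)) ⟨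
    k + ⌈ length p /2⌉ ∸ k            ≡⟨ m+n∸m≡n k ⌈ length p /2⌉ ⟩
    ⌈ length p /2⌉                    ∎
    where
    open ≡-Reasoning
    k = ⌊ length p /2⌋

  palindromeOfLength : ℕ → Word q → Word q
  palindromeOfLength l y = take ⌊ l /2⌋ (reverse y) ++ y

  palindromeOfLength-rightHalf : ∀ p → IsPalindrome p → palindromeOfLength (length p) (rightHalf p) ≡ p
  palindromeOfLength-rightHalf p p-pal = begin
    take k (reverse y) ++ y          ≡⟨ cong (_++ y) take-k-reverse-y ⟩
    take k p ++ y                    ≡⟨ take++drop≡id k p ⟩
    p                                ∎
    where
    open ≡-Reasoning
    k = ⌊ length p /2⌋
    x = take k p
    y = rightHalf p
    k≤|reverse-y| : k ≤ length (reverse y)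
    k≤|reverse-y| = ≤-trans (⌊n/2⌋≤⌈n/2⌉ (length p))
      (≤-reflexive (sym (trans (length-reverse y) (length-rightHalf p))))
    take-k-reverse-y : take k (reverse y) ≡ x
    take-k-reverse-y = begin
      take k (reverse y)               ≡⟨ take-++-≤ k (reverse y) (reverse x) k≤|reverse-y| ⟨
      take k (reverse y ++ reverse x)  ≡⟨ cong (take k) (reverse-++ x y) ⟨
      take k (reverse (x ++ y))        ≡⟨ cong (λ v → take k (reverse v)) (take++drop≡id k p) ⟩
      take k (reverse p)               ≡⟨ cong (take k) p-pal ⟩
      x                                ∎

  IsRich-rightHalf : ∀ p → IsRich p → IsRich (rightHalf p)
  IsRich-rightHalf p rich =
    IsRich-++⁻ʳ (take ⌊ length p /2⌋ p) (rightHalf p) (subst IsRich (sym (take++drop≡id ⌊ length p /2⌋ p)) rich)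

module _ {A : Set} where

  concat₁ : ℕ → (ℕ → List A) → List A
  concat₁ zero    F = []
  concat₁ (suc m) F = F 1 ++ concat₁ m (λ i → F (suc i))

  ∈-concat₁⁺ : ∀ m (F : ℕ → List A) {x} i → 1 ≤ i → i ≤ m → x ∈ F i → x ∈ concat₁ m F
  ∈-concat₁⁺ (suc m) F 1             _ _        x∈ = ∈-++⁺ˡ x∈
  ∈-concat₁⁺ (suc m) F (suc (suc i)) _ (s≤s i≤) x∈ =
    ∈-++⁺ʳ (F 1) (∈-concat₁⁺ m (λ j → F (suc j)) (suc i) (s≤s z≤n) i≤ x∈)

sum₁ : ℕ → (ℕ → ℕ) → ℕ
sum₁ zero    f = 0
sum₁ (suc m) f = f 1 + sum₁ m (λ i → f (suc i))

length-concat₁ : ∀ {A : Set} m (F : ℕ → List A) → length (concat₁ m F) ≡ sum₁ m (λ i → length (F i))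
length-concat₁ zero    F = refl
length-concat₁ (suc m) F = trans (length-++ (F 1)) (cong (length (F 1) +_) (length-concat₁ m (λ i → F (suc i))))

sum₁-cong : ∀ m {f g : ℕ → ℕ} → (∀ i → f i ≡ g i) → sum₁ m f ≡ sum₁ m g
sum₁-cong zero    f≗g = refl
sum₁-cong (suc m) f≗g = cong₂ _+_ (f≗g 1) (sum₁-cong m (λ i → f≗g (suc i)))

sum₁-mono-≤ : ∀ m {f g : ℕ → ℕ} → (∀ i → 1 ≤ i → i ≤ m → f i ≤ g i) → sum₁ m f ≤ sum₁ m g
sum₁-mono-≤ zero    f≤g = z≤n
sum₁-mono-≤ (suc m) f≤g = +-mono-≤ (f≤g 1 (s≤s z≤n) (s≤s z≤n))
  (sum₁-mono-≤ m (λ i _ i≤m → f≤g (suc i) (s≤s z≤n) (s≤s i≤m)))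

sum₁-*ˡ : ∀ m x (f : ℕ → ℕ) → sum₁ m (λ i → x * f i) ≡ x * sum₁ m f
sum₁-*ˡ zero    x f = sym (*-zeroʳ x)
sum₁-*ˡ (suc m) x f = trans (cong (x * f 1 +_) (sum₁-*ˡ m x (λ i → f (suc i)))) (sym (*-distribˡ-+ x (f 1) _))

sum₁-*ʳ : ∀ m x (f : ℕ → ℕ) → sum₁ m f * x ≡ sum₁ m (λ i → f i * x)
sum₁-*ʳ zero    x f = refl
sum₁-*ʳ (suc m) x f = trans (*-distribʳ-+ x (f 1) _) (cong (f 1 * x +_) (sum₁-*ʳ m x (λ i → f (suc i))))

sum₁-≤-* : ∀ m (f : ℕ → ℕ) b → (∀ i → 1 ≤ i → i ≤ m → f i ≤ b) → sum₁ m f ≤ m * b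
sum₁-≤-* zero    f b f≤b = z≤n
sum₁-≤-* (suc m) f b f≤b = +-mono-≤ (f≤b 1 (s≤s z≤n) (s≤s z≤n))
  (sum₁-≤-* m (λ i → f (suc i)) b (λ i _ i≤m → f≤b (suc i) (s≤s z≤n) (s≤s i≤m)))

module Candidates {q : ℕ} (L : ℕ) where
  open Palindromes {q}
  open Halves {q}

  shortWords : List (Word q)
  shortWords = concat₁ L (words q)

  ∈-shortWords : ∀ {u : Word q} → 1 ≤ length u → length u ≤ L → u ∈ shortWords
  ∈-shortWords {u} 1≤|u| |u|≤L = ∈-concat₁⁺ L (words q) (length u) 1≤|u| |u|≤L (∈-words u)

  withPalPrefix : ℕ → List (Word q) → List (Word q)
  withPalPrefix l Y = cartesianProductWith (λ h y → palindromeOfLength l h ++ y) (richWords q ⌈ l /2⌉) Y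

  longStep : (ℕ → ℕ → List (Word q)) → ℕ → ℕ → List (Word q)
  longStep C n s = concat₁ (n ∸ L) λ i → withPalPrefix (L + i) (C (n ∸ L ∸ i) s)

  shortStep : (ℕ → ℕ → List (Word q)) → ℕ → ℕ → List (Word q)
  shortStep C n zero    = []
  shortStep C n (suc s) = concat₁ L λ l → cartesianProductWith _++_ (words q l) (C (n ∸ l) s)

  -- For n ≤ f, candidates f n s contains every rich word of length n whose factorisation into
  -- new palindromic prefixes has at most s distinct pieces of length ≤ L; f is fuel.
  candidates : ℕ → ℕ → ℕ → List (Word q)
  candidates zero    n s = [ [] ]
  candidates (suc f) n s = [] ∷ (longStep (candidates f) n s ++ shortStep (candidates f) n s)

  ∈-longStep : ∀ C n s {p y : Word q} → IsPalindrome p → IsRich p → L < length p → length p + length y ≡ n →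
               y ∈ C (length y) s → p ++ y ∈ longStep C n s
  ∈-longStep C n s {p} {y} p-pal p-rich L<|p| |p|+|y|≡n y∈ =
    ∈-concat₁⁺ (n ∸ L) _ i (m<n⇒0<n∸m L<|p|) (∸-monoˡ-≤ L (m+n≤o⇒m≤o (length p) (≤-reflexive |p|+|y|≡n)))
      (subst₂ (λ l m → p ++ y ∈ withPalPrefix l (C m s)) (sym L+i≡|p|) (sym n∸L∸i≡|y|) p++y∈)
    where
    i = length p ∸ L
    L+i≡|p| : L + i ≡ length p
    L+i≡|p| = m+[n∸m]≡n (<⇒≤ L<|p|)
    n∸L∸i≡|y| : n ∸ L ∸ i ≡ length y
    n∸L∸i≡|y| = begin
      n ∸ L ∸ i                      ≡⟨ ∸-+-assoc n L i ⟩
      n ∸ (L + i)                    ≡⟨ cong₂ _∸_ (sym |p|+|y|≡n) L+i≡|p| ⟩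
      length p + length y ∸ length p ≡⟨ m+n∸m≡n (length p) (length y) ⟩
      length y                       ∎
      where open ≡-Reasoning
    half∈ : rightHalf p ∈ richWords q ⌈ length p /2⌉
    half∈ = subst (λ l → rightHalf p ∈ richWords q l) (length-rightHalf p) (∈-richWords (IsRich-rightHalf p p-rich))
    p++y∈ : p ++ y ∈ withPalPrefix (length p) (C (length y) s)
    p++y∈ = subst (λ v → v ++ y ∈ withPalPrefix (length p) (C (length y) s)) (palindromeOfLength-rightHalf p p-pal)
      (∈-cartesianProductWith⁺ (λ h y → palindromeOfLength (length p) h ++ y) half∈ y∈)

  ∈-shortStep : ∀ C n s {p y : Word q} → 1 ≤ length p → length p ≤ L → length p + length y ≡ n →
                y ∈ C (length y) s → p ++ y ∈ shortStep C n (suc s)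
  ∈-shortStep C n s {p} {y} 1≤|p| |p|≤L |p|+|y|≡n y∈ = ∈-concat₁⁺ L _ (length p) 1≤|p| |p|≤L
    (∈-cartesianProductWith⁺ _++_ (∈-words p) (subst (λ m → y ∈ C m s) |y|≡n∸|p| y∈))
    where
    |y|≡n∸|p| : length y ≡ n ∸ length p
    |y|≡n∸|p| = sym (trans (cong (_∸ length p) (sym |p|+|y|≡n)) (m+n∸m≡n (length p) (length y)))

  []∈candidates : ∀ f n s → [] ∈ candidates f n s
  []∈candidates zero    n s = here refl
  []∈candidates (suc f) n s = here refl

  record Cover (f : ℕ) (w : Word q) : Set where
    field
      shortPieces        : List (Word q)
      shortPieces-unique : Unique shortPieces
      shortPieces-short  : shortPieces ⊆ shortWords
      shortPieces-factor : ∀ {u} → u ∈ shortPieces → Factor u w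
      ∈-candidates       : ∀ s → length shortPieces ≤ s → w ∈ candidates f (length w) s

  Cover-++-long : ∀ {f p y} → IsPalindrome p → IsRich p → L < length p → Cover f y → Cover (suc f) (p ++ y)
  Cover-++-long {f} {p} {y} p-pal p-rich L<|p| cover-y = record
    { shortPieces        = Y.shortPieces
    ; shortPieces-unique = Y.shortPieces-unique
    ; shortPieces-short  = Y.shortPieces-short
    ; shortPieces-factor = λ u∈ → Factor-prepend p (Y.shortPieces-factor u∈)
    ; ∈-candidates       = λ s |pieces|≤s → there (∈-++⁺ˡ
        (∈-longStep (candidates f) _ s p-pal p-rich L<|p| (sym (length-++ p)) (Y.∈-candidates s |pieces|≤s)))
    }
    where module Y = Cover cover-y

  Cover-++-short : ∀ {f p y} → ¬ Factor p y → 1 ≤ length p → length p ≤ L → Cover f y → Cover (suc f) (p ++ y)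
  Cover-++-short {f} {p} {y} p∉y 1≤|p| |p|≤L cover-y = record
    { shortPieces        = p ∷ Y.shortPieces
    ; shortPieces-unique = All.tabulate (λ { u∈ refl → p∉y (Y.shortPieces-factor u∈) }) ∷ Y.shortPieces-unique
    ; shortPieces-short  = λ where
        (here refl) → ∈-shortWords 1≤|p| |p|≤L
        (there u∈)  → Y.shortPieces-short u∈
    ; shortPieces-factor = λ where
        (here refl) → [] , y , refl
        (there u∈)  → Factor-prepend p (Y.shortPieces-factor u∈)
    ; ∈-candidates       = λ where
        (suc s) (s≤s |pieces|≤s) → there (∈-++⁺ʳ (longStep (candidates f) _ (suc s))
          (∈-shortStep (candidates f) _ s 1≤|p| |p|≤L (sym (length-++ p)) (Y.∈-candidates s |pieces|≤s)))
    }
    where module Y = Cover cover-y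

  IsRich⇒Cover : ∀ f w → length w ≤ f → IsRich w → Cover f w
  IsRich⇒Cover f [] _ _ = record
    { shortPieces = [] ; shortPieces-unique = [] ; shortPieces-short = λ ()
    ; shortPieces-factor = λ () ; ∈-candidates = λ s _ → []∈candidates f 0 s }
  IsRich⇒Cover (suc f) (a ∷ w) (s≤s |w|≤f) rich with IsRich-∷⇒NewPalPrefix a w rich
  ... | [] , _ , _ , []∉w = ⊥-elim ([]∉w (Factor-[] w))
  ... | p@(b ∷ p′) , (y , p++y≡) , p-pal , p∉w = subst (Cover (suc f)) p++y≡ cover
    where
    p′++y≡w : p′ ++ y ≡ w
    p′++y≡w = ∷-injectiveʳ p++y≡
    p++y-rich : IsRich (p ++ y)
    p++y-rich = subst IsRich (sym p++y≡) rich
    |y|≤f : length y ≤ f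
    |y|≤f = ≤-trans (m≤n+m (length y) (length p′))
      (≤-trans (≤-reflexive (trans (sym (length-++ p′)) (cong length p′++y≡w))) |w|≤f)
    cover-y : Cover f y
    cover-y = IsRich⇒Cover f y |y|≤f (IsRich-++⁻ʳ p y p++y-rich)
    p∉y : ¬ Factor p y
    p∉y p∈y = p∉w (subst (Factor p) p′++y≡w (Factor-prepend p′ p∈y))
    cover : Cover (suc f) (p ++ y)
    cover with L <? length p
    ... | yes L<|p| = Cover-++-long p-pal (IsRich-++⁻ˡ p y p++y-rich) L<|p| cover-y
    ... | no  L≮|p| = Cover-++-short p∉y (s≤s z≤n) (≮⇒≥ L≮|p|) cover-y

  richCount≤length-candidates : ∀ n → richCount q n ≤ length (candidates n n (length shortWords))
  richCount≤length-candidates n =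
    Unique-⊆⇒length≤ (Unique.filter⁺ rich? (words-unique q n)) rich⇒∈candidates
    where
    rich⇒∈candidates : richWords q n ⊆ candidates n n (length shortWords)
    rich⇒∈candidates {w} w∈ with ∈-filter⁻ rich? {xs = words q n} w∈
    ... | w∈words , rich with ∈-words⁻ n w∈words
    ... | refl = Cover.∈-candidates cover (length shortWords)
                   (Unique-⊆⇒length≤ (Cover.shortPieces-unique cover) (Cover.shortPieces-short cover))
      where cover = IsRich⇒Cover n w ≤-refl rich

-- Growth estimates

^-distribʳ-* : ∀ m n o → (m * n) ^ o ≡ m ^ o * n ^ o
^-distribʳ-* m n zero    = refl
^-distribʳ-* m n (suc o) = begin
  m * n * (m * n) ^ o       ≡⟨ cong (m * n *_) (^-distribʳ-* m n o) ⟩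
  m * n * (m ^ o * n ^ o)   ≡⟨ lemma m n (m ^ o) (n ^ o) ⟩
  m * m ^ o * (n * n ^ o)   ∎
  where
  open ≡-Reasoning
  lemma : ∀ m n x y → m * n * (x * y) ≡ m * x * (n * y)
  lemma = solve-∀

^-monoʳ-≤′ : ∀ {m n o} → 1 ≤ m → n ≤ o → m ^ n ≤ m ^ o
^-monoʳ-≤′ {m} 1≤m = ^-monoʳ-≤ m {{>-nonZero 1≤m}}

bernoulli : ∀ x n → x ^ n * (x + n) ≤ x * suc x ^ n
bernoulli x zero    = ≤-reflexive (lemma x)
  where
  lemma : ∀ x → 1 * (x + 0) ≡ x * 1
  lemma = solve-∀
bernoulli x (suc n) = begin
  x * x ^ n * (x + suc n)           ≡⟨ lemma₁ x (x ^ n) n ⟩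
  x ^ n * (x + x * (x + n))         ≤⟨ *-monoʳ-≤ (x ^ n) (+-monoˡ-≤ (x * (x + n)) (m≤m+n x n)) ⟩
  x ^ n * ((x + n) + x * (x + n))   ≡⟨ lemma₂ x (x ^ n) n ⟩
  suc x * (x ^ n * (x + n))         ≤⟨ *-monoʳ-≤ (suc x) (bernoulli x n) ⟩
  suc x * (x * suc x ^ n)           ≡⟨ *-assoc (suc x) x _ ⟨
  suc x * x * suc x ^ n             ≡⟨ cong (_* suc x ^ n) (*-comm (suc x) x) ⟩
  x * suc x * suc x ^ n             ≡⟨ *-assoc x (suc x) _ ⟩
  x * (suc x * suc x ^ n)           ∎
  where
  open ≤-Reasoning
  lemma₁ : ∀ x p n → x * p * (x + suc n) ≡ p * (x + x * (x + n))
  lemma₁ = solve-∀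
  lemma₂ : ∀ x p n → p * ((x + n) + x * (x + n)) ≡ suc x * (p * (x + n))
  lemma₂ = solve-∀

*^<suc^ : ∀ x K n → K * x < n → K * x ^ n < suc x ^ n
*^<suc^ zero    K (suc n) _ = ≤-reflexive (trans (cong suc (*-zeroʳ K)) (sym (^-zeroˡ (suc n))))
*^<suc^ (suc x) K n Kx<n = *-cancelˡ-< (suc x) _ _ (begin-strict
  suc x * (K * suc x ^ n)     ≡⟨ lemma (suc x) K (suc x ^ n) ⟩
  suc x ^ n * (K * suc x)     <⟨ *-monoʳ-< (suc x ^ n) {{m^n≢0 (suc x) n}} (≤-trans Kx<n (m≤n+m n (suc x))) ⟩
  suc x ^ n * (suc x + n)     ≤⟨ bernoulli (suc x) n ⟩
  suc x * suc (suc x) ^ n     ∎)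
  where
  open ≤-Reasoning
  lemma : ∀ a K p → a * (K * p) ≡ p * (K * a)
  lemma = solve-∀

geometric : ∀ M m → sum₁ m (λ i → M ^ i * suc M ^ (m ∸ i)) + M ^ suc m ≡ M * suc M ^ m
geometric M zero    = refl
geometric M (suc m) = begin
  (M ^ 1 * suc M ^ m + sum₁ m (λ i → M ^ suc i * suc M ^ (m ∸ i))) + M * M ^ suc m
    ≡⟨ cong (λ t → (M ^ 1 * suc M ^ m + t) + M * M ^ suc m)
         (trans (sum₁-cong m (λ i → *-assoc M (M ^ i) _)) (sum₁-*ˡ m M _)) ⟩
  (M ^ 1 * suc M ^ m + M * G) + M * M ^ suc m
    ≡⟨ lemma₁ M (suc M ^ m) G (M ^ suc m) ⟩
  M * suc M ^ m + M * (G + M ^ suc m)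
    ≡⟨ cong (λ t → M * suc M ^ m + M * t) (geometric M m) ⟩
  M * suc M ^ m + M * (M * suc M ^ m)
    ≡⟨ lemma₂ M (suc M ^ m) ⟩
  M * (suc M * suc M ^ m) ∎
  where
  open ≡-Reasoning
  G = sum₁ m (λ i → M ^ i * suc M ^ (m ∸ i))
  lemma₁ : ∀ M S g P → (M * 1 * S + M * g) + M * P ≡ M * S + M * (g + P)
  lemma₁ = solve-∀
  lemma₂ : ∀ M S → M * S + M * (M * S) ≡ M * (suc M * S)
  lemma₂ = solve-∀

geometric-≤ : ∀ M m → sum₁ m (λ i → M ^ i * suc M ^ (m ∸ i)) ≤ M * suc M ^ m
geometric-≤ M m = ≤-trans (m≤m+n _ (M ^ suc m)) (≤-reflexive (geometric M m))

RichCountBound : ℕ → ℕ → ℕ → Set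
RichCountBound q a b = ∃[ K ] (∀ n → richCount q n * a ^ n ≤ K * b ^ n)

RichCountBound-weaken : ∀ {q A B x y} → x ≤ y → RichCountBound q A B → RichCountBound q (A * x) (B * y)
RichCountBound-weaken {q} {A} {B} {x} {y} x≤y (K , bound) = K , λ n → begin
  richCount q n * (A * x) ^ n       ≡⟨ cong (richCount q n *_) (^-distribʳ-* A x n) ⟩
  richCount q n * (A ^ n * x ^ n)   ≡⟨ *-assoc (richCount q n) _ _ ⟨
  richCount q n * A ^ n * x ^ n     ≤⟨ *-mono-≤ (bound n) (^-monoˡ-≤ n x≤y) ⟩
  K * B ^ n * y ^ n                 ≡⟨ *-assoc K _ _ ⟩
  K * (B ^ n * y ^ n)               ≡⟨ cong (K *_) (^-distribʳ-* B y n) ⟨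
  K * (B * y) ^ n                   ∎
  where open ≤-Reasoning

-- A long first piece of length l contributes R_⌈l/2⌉ c^l ≤ K b (b M)^l against d^l = (b (M + 1))^l;
-- L-large makes the words with a long first piece account for at most half of the bound E s dⁿ.
module Bootstrap {q : ℕ} (1≤q : 1 ≤ q) (M : ℕ) (1≤M : 1 ≤ M) (a b K : ℕ) (1≤a : 1 ≤ a) (a≤b : a ≤ b)
  (richCount-bound : ∀ h → richCount q h * (a * a) ^ h ≤ K * (b * b) ^ h)
  (L : ℕ) (L-large : 2 * (K * b) * (M * M ^ L) ≤ suc M ^ L) where
  open Candidates {q} L

  c d : ℕ
  c = a * M
  d = b * suc M

  c≤d : c ≤ d
  c≤d = *-mono-≤ a≤b (n≤1+n M)

  1≤c : 1 ≤ c
  1≤c = *-mono-≤ 1≤a 1≤M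

  1≤b : 1 ≤ b
  1≤b = ≤-trans 1≤a a≤b

  1≤d : 1 ≤ d
  1≤d = ≤-trans 1≤c c≤d

  E Z : ℕ → ℕ
  E s = 2 + 2 * Z s
  Z zero    = 0
  Z (suc s) = L * (q ^ L * (d ^ L * E s))

  richCount-⌈/2⌉ : ∀ l → richCount q ⌈ l /2⌉ * c ^ l ≤ K * b * (b ^ l * M ^ l)
  richCount-⌈/2⌉ l = begin
    R * c ^ l               ≡⟨ cong (R *_) (^-distribʳ-* a M l) ⟩
    R * (a ^ l * M ^ l)     ≡⟨ *-assoc R (a ^ l) (M ^ l) ⟨
    R * a ^ l * M ^ l       ≤⟨ *-monoˡ-≤ (M ^ l) (*-monoʳ-≤ R (^-monoʳ-≤′ 1≤a (n≤⌈n/2⌉+⌈n/2⌉ l))) ⟩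
    R * a ^ (h + h) * M ^ l ≡⟨ cong (λ t → R * t * M ^ l) (a^[h+h]≡[a*a]^h a) ⟩
    R * (a * a) ^ h * M ^ l ≤⟨ *-monoˡ-≤ (M ^ l) (richCount-bound h) ⟩
    K * (b * b) ^ h * M ^ l ≡⟨ cong (λ t → K * t * M ^ l) (a^[h+h]≡[a*a]^h b) ⟨
    K * b ^ (h + h) * M ^ l ≤⟨ *-monoˡ-≤ (M ^ l) (*-monoʳ-≤ K (^-monoʳ-≤′ 1≤b (⌈n/2⌉+⌈n/2⌉≤1+n l))) ⟩
    K * (b * b ^ l) * M ^ l ≡⟨ lemma K b (b ^ l) (M ^ l) ⟩
    K * b * (b ^ l * M ^ l) ∎
    where
    open ≤-Reasoning
    R = richCount q ⌈ l /2⌉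
    h = ⌈ l /2⌉
    a^[h+h]≡[a*a]^h : ∀ x → x ^ (h + h) ≡ (x * x) ^ h
    a^[h+h]≡[a*a]^h x = trans (^-distribˡ-+-* x h h) (sym (^-distribʳ-* x x h))
    lemma : ∀ K b B P → K * (b * B) * P ≡ K * b * (B * P)
    lemma = solve-∀

  module _ (C : ℕ → ℕ → List (Word q)) (s : ℕ)
           (C-bound : ∀ m → length (C m s) * c ^ m ≤ E s * d ^ m) where

    longTerm : ℕ → ℕ → ℕ
    longTerm m i = richCount q ⌈ L + i /2⌉ * length (C (m ∸ i) s)

    length-longStep : ∀ n → length (longStep C n s) ≡ sum₁ (n ∸ L) (longTerm (n ∸ L))
    length-longStep n = trans (length-concat₁ (n ∸ L) _) (sum₁-cong (n ∸ L) λ i →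
      length-cartesianProductWith _ (richWords q ⌈ L + i /2⌉) (C (n ∸ L ∸ i) s))

    longTerm-bound : ∀ m i → i ≤ m →
      longTerm m i * c ^ (L + m) ≤ E s * (K * b) * b ^ (L + m) * M ^ L * (M ^ i * suc M ^ (m ∸ i))
    longTerm-bound m i i≤m = begin
      R * Cj * c ^ (L + m)
        ≡⟨ cong (λ t → R * Cj * c ^ t) L+m≡ ⟩
      R * Cj * c ^ ((L + i) + j)
        ≡⟨ cong (R * Cj *_) (^-distribˡ-+-* c (L + i) j) ⟩
      R * Cj * (c ^ (L + i) * c ^ j)
        ≡⟨ lemma₁ R Cj (c ^ (L + i)) (c ^ j) ⟩
      (R * c ^ (L + i)) * (Cj * c ^ j)
        ≤⟨ *-mono-≤ (richCount-⌈/2⌉ (L + i)) (C-bound j) ⟩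
      (K * b * (b ^ (L + i) * M ^ (L + i))) * (E s * d ^ j)
        ≡⟨ cong₂ (λ t u → (K * b * (b ^ (L + i) * t)) * (E s * u))
                 (^-distribˡ-+-* M L i) (^-distribʳ-* b (suc M) j) ⟩
      (K * b * (b ^ (L + i) * (M ^ L * M ^ i))) * (E s * (b ^ j * suc M ^ j))
        ≡⟨ lemma₂ (K * b) (b ^ (L + i)) (M ^ L) (M ^ i) (E s) (b ^ j) (suc M ^ j) ⟩
      E s * (K * b) * (b ^ (L + i) * b ^ j) * M ^ L * (M ^ i * suc M ^ j)
        ≡⟨ cong (λ t → E s * (K * b) * t * M ^ L * (M ^ i * suc M ^ j)) (^-distribˡ-+-* b (L + i) j) ⟨
      E s * (K * b) * b ^ ((L + i) + j) * M ^ L * (M ^ i * suc M ^ j)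
        ≡⟨ cong (λ t → E s * (K * b) * b ^ t * M ^ L * (M ^ i * suc M ^ j)) L+m≡ ⟨
      E s * (K * b) * b ^ (L + m) * M ^ L * (M ^ i * suc M ^ j) ∎
      where
      open ≤-Reasoning
      R = richCount q ⌈ L + i /2⌉
      j = m ∸ i
      Cj = length (C j s)
      L+m≡ : L + m ≡ (L + i) + j
      L+m≡ = trans (cong (L +_) (sym (m+[n∸m]≡n i≤m))) (sym (+-assoc L i j))
      lemma₁ : ∀ R C x y → R * C * (x * y) ≡ (R * x) * (C * y)
      lemma₁ = solve-∀
      lemma₂ : ∀ Kb BL ML Mi Es Bj Sj →
        (Kb * (BL * (ML * Mi))) * (Es * (Bj * Sj)) ≡ Es * Kb * (BL * Bj) * ML * (Mi * Sj)
      lemma₂ = solve-∀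

    longSum-bound : ∀ m → 2 * sum₁ m (longTerm m) * c ^ (L + m) ≤ E s * d ^ (L + m)
    longSum-bound m = begin
      2 * sum₁ m (longTerm m) * c ^ (L + m)
        ≡⟨ *-assoc 2 (sum₁ m (longTerm m)) (c ^ (L + m)) ⟩
      2 * (sum₁ m (longTerm m) * c ^ (L + m))
        ≡⟨ cong (2 *_) (sum₁-*ʳ m (c ^ (L + m)) (longTerm m)) ⟩
      2 * sum₁ m (λ i → longTerm m i * c ^ (L + m))
        ≤⟨ *-monoʳ-≤ 2 (sum₁-mono-≤ m (λ i _ i≤m → longTerm-bound m i i≤m)) ⟩
      2 * sum₁ m (λ i → X * (M ^ i * suc M ^ (m ∸ i)))
        ≡⟨ cong (2 *_) (sum₁-*ˡ m X _) ⟩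
      2 * (X * sum₁ m (λ i → M ^ i * suc M ^ (m ∸ i)))
        ≤⟨ *-monoʳ-≤ 2 (*-monoʳ-≤ X (geometric-≤ M m)) ⟩
      2 * (X * (M * suc M ^ m))
        ≡⟨ lemma₁ (E s) (K * b) (b ^ (L + m)) (M ^ L) M (suc M ^ m) ⟩
      E s * b ^ (L + m) * (2 * (K * b) * (M * M ^ L)) * suc M ^ m
        ≤⟨ *-monoˡ-≤ (suc M ^ m) (*-monoʳ-≤ (E s * b ^ (L + m)) L-large) ⟩
      E s * b ^ (L + m) * suc M ^ L * suc M ^ m
        ≡⟨ lemma₂ (E s) (b ^ (L + m)) (suc M ^ L) (suc M ^ m) ⟩
      E s * (b ^ (L + m) * (suc M ^ L * suc M ^ m))
        ≡⟨ cong (λ t → E s * (b ^ (L + m) * t)) (^-distribˡ-+-* (suc M) L m) ⟨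
      E s * (b ^ (L + m) * suc M ^ (L + m))
        ≡⟨ cong (E s *_) (^-distribʳ-* b (suc M) (L + m)) ⟨
      E s * d ^ (L + m) ∎
      where
      open ≤-Reasoning
      X = E s * (K * b) * b ^ (L + m) * M ^ L
      lemma₁ : ∀ Es Kb BLm ML M S → 2 * (Es * Kb * BLm * ML * (M * S)) ≡ Es * BLm * (2 * Kb * (M * ML)) * S
      lemma₁ = solve-∀
      lemma₂ : ∀ Es B x y → Es * B * x * y ≡ Es * (B * (x * y))
      lemma₂ = solve-∀

    longStep-bound : ∀ n → 2 * length (longStep C n s) * c ^ n ≤ E s * d ^ n
    longStep-bound n with L ≤? n
    ... | yes L≤n = begin
      2 * length (longStep C n s) * c ^ n   ≡⟨ cong (λ t → 2 * t * c ^ n) (length-longStep n) ⟩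
      2 * sum₁ m (longTerm m) * c ^ n       ≡⟨ cong (λ t → 2 * sum₁ m (longTerm m) * c ^ t) L+m≡n ⟨
      2 * sum₁ m (longTerm m) * c ^ (L + m) ≤⟨ longSum-bound m ⟩
      E s * d ^ (L + m)                     ≡⟨ cong (λ t → E s * d ^ t) L+m≡n ⟩
      E s * d ^ n                           ∎
      where
      open ≤-Reasoning
      m = n ∸ L
      L+m≡n : L + m ≡ n
      L+m≡n = m+[n∸m]≡n L≤n
    ... | no L≰n rewrite length-longStep n | m≤n⇒m∸n≡0 (<⇒≤ (≰⇒> L≰n)) = z≤n

    length-shortStep : ∀ n → length (shortStep C n (suc s)) ≡ sum₁ L (λ l → q ^ l * length (C (n ∸ l) s))
    length-shortStep n = trans (length-concat₁ L _) (sum₁-cong L λ l →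
      trans (length-cartesianProductWith _++_ (words q l) (C (n ∸ l) s))
            (cong (_* length (C (n ∸ l) s)) (length-words q l)))

    shortTerm-bound : ∀ n l → l ≤ L → q ^ l * length (C (n ∸ l) s) * c ^ n ≤ q ^ L * (d ^ L * E s) * d ^ n
    shortTerm-bound n l l≤L = begin
      Q * Cl * c ^ n
        ≤⟨ *-monoʳ-≤ (Q * Cl) (^-monoʳ-≤′ 1≤c (m≤n+m∸n n l)) ⟩
      Q * Cl * c ^ (l + (n ∸ l))
        ≡⟨ cong (Q * Cl *_) (^-distribˡ-+-* c l (n ∸ l)) ⟩
      Q * Cl * (c ^ l * c ^ (n ∸ l))
        ≡⟨ lemma₁ Q Cl (c ^ l) (c ^ (n ∸ l)) ⟩
      (Q * c ^ l) * (Cl * c ^ (n ∸ l))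
        ≤⟨ *-mono-≤ (*-mono-≤ (^-monoʳ-≤′ 1≤q l≤L) c^l≤d^L) (C-bound (n ∸ l)) ⟩
      (q ^ L * d ^ L) * (E s * d ^ (n ∸ l))
        ≤⟨ *-monoʳ-≤ (q ^ L * d ^ L) (*-monoʳ-≤ (E s) (^-monoʳ-≤′ 1≤d (m∸n≤m n l))) ⟩
      (q ^ L * d ^ L) * (E s * d ^ n)
        ≡⟨ lemma₂ (q ^ L) (d ^ L) (E s) (d ^ n) ⟩
      q ^ L * (d ^ L * E s) * d ^ n ∎
      where
      open ≤-Reasoning
      Q = q ^ l
      Cl = length (C (n ∸ l) s)
      c^l≤d^L : c ^ l ≤ d ^ L
      c^l≤d^L = ≤-trans (^-monoˡ-≤ l c≤d) (^-monoʳ-≤′ 1≤d l≤L)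
      lemma₁ : ∀ Q C x y → Q * C * (x * y) ≡ (Q * x) * (C * y)
      lemma₁ = solve-∀
      lemma₂ : ∀ a b e x → (a * b) * (e * x) ≡ a * (b * e) * x
      lemma₂ = solve-∀

    shortStep-bound : ∀ n → length (shortStep C n (suc s)) * c ^ n ≤ Z (suc s) * d ^ n
    shortStep-bound n = begin
      length (shortStep C n (suc s)) * c ^ n
        ≡⟨ cong (_* c ^ n) (length-shortStep n) ⟩
      sum₁ L (λ l → q ^ l * length (C (n ∸ l) s)) * c ^ n
        ≡⟨ sum₁-*ʳ L (c ^ n) _ ⟩
      sum₁ L (λ l → q ^ l * length (C (n ∸ l) s) * c ^ n)
        ≤⟨ sum₁-≤-* L _ _ (λ l _ l≤L → shortTerm-bound n l l≤L) ⟩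
      L * (q ^ L * (d ^ L * E s) * d ^ n)
        ≡⟨ *-assoc L _ (d ^ n) ⟨
      Z (suc s) * d ^ n ∎
      where open ≤-Reasoning

  candidates-bound : ∀ f n s → length (candidates f n s) * c ^ n ≤ E s * d ^ n
  candidates-bound zero    n s = begin
    c ^ n + 0   ≡⟨ +-identityʳ (c ^ n) ⟩
    c ^ n       ≤⟨ ^-monoˡ-≤ n c≤d ⟩
    d ^ n       ≤⟨ m≤n*m (d ^ n) (E s) ⟩
    E s * d ^ n ∎
    where open ≤-Reasoning
  candidates-bound (suc f) n s = *-cancelˡ-≤ 2 (begin
    2 * (length ([] ∷ (Long ++ Short)) * c ^ n)
      ≡⟨ cong (λ t → 2 * (suc t * c ^ n)) (length-++ Long) ⟩
    2 * (suc (length Long + length Short) * c ^ n)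
      ≡⟨ lemma₁ (length Long) (length Short) (c ^ n) ⟩
    2 * c ^ n + 2 * length Long * c ^ n + 2 * (length Short * c ^ n)
      ≤⟨ +-mono-≤ (+-mono-≤ (*-monoʳ-≤ 2 (^-monoˡ-≤ n c≤d)) long-bound) (*-monoʳ-≤ 2 (short-bound s)) ⟩
    2 * d ^ n + E s * d ^ n + 2 * (Z s * d ^ n)
      ≡⟨ lemma₂ (d ^ n) (Z s) ⟩
    2 * (E s * d ^ n) ∎)
    where
    open ≤-Reasoning
    Long = longStep (candidates f) n s
    Short = shortStep (candidates f) n s
    long-bound : 2 * length Long * c ^ n ≤ E s * d ^ n
    long-bound = longStep-bound (candidates f) s (λ m → candidates-bound f m s) n
    short-bound : ∀ s → length (shortStep (candidates f) n s) * c ^ n ≤ Z s * d ^ n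
    short-bound zero    = z≤n
    short-bound (suc s) = shortStep-bound (candidates f) s (λ m → candidates-bound f m s) n
    lemma₁ : ∀ A B C → 2 * (suc (A + B) * C) ≡ 2 * C + 2 * A * C + 2 * (B * C)
    lemma₁ = solve-∀
    lemma₂ : ∀ D Y → 2 * D + (2 + 2 * Y) * D + 2 * (Y * D) ≡ 2 * ((2 + 2 * Y) * D)
    lemma₂ = solve-∀

richCount≤q^n : ∀ q n → richCount q n ≤ q ^ n
richCount≤q^n q n = ≤-trans (length-filter rich? (words q n)) (≤-reflexive (length-words q n))

bootstrap : ∀ {q} → 1 ≤ q → ∀ M → 1 ≤ M → ∀ {a b} → 1 ≤ a → a ≤ b →
            RichCountBound q (a * a) (b * b) → RichCountBound q (a * M) (b * suc M)
bootstrap {q} 1≤q M 1≤M {a} {b} 1≤a a≤b (K , bound) =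
  E (length shortWords) , λ n →
    ≤-trans (*-monoˡ-≤ ((a * M) ^ n) (richCount≤length-candidates n)) (candidates-bound n n (length shortWords))
  where
  L = suc (2 * (K * b) * M * M)
  L-large : 2 * (K * b) * (M * M ^ L) ≤ suc M ^ L
  L-large = ≤-trans (≤-reflexive (sym (*-assoc (2 * (K * b)) M (M ^ L))))
                    (<⇒≤ (*^<suc^ M (2 * (K * b) * M) L ≤-refl))
  open Candidates {q} L
  open Bootstrap 1≤q M 1≤M a b K 1≤a a≤b bound L L-large

module Descent {q : ℕ} (1≤q : 1 ≤ q) (M : ℕ) (1≤M : 1 ≤ M) where

  Rate : ℕ → Set
  Rate f = RichCountBound q (M ^ f) (suc M ^ f)

  Rate-mono : ∀ {f g} → f ≤ g → Rate f → Rate g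
  Rate-mono {f} {g} f≤g r = subst₂ (RichCountBound q) (split M) (split (suc M))
    (RichCountBound-weaken (^-monoˡ-≤ (g ∸ f) (n≤1+n M)) r)
    where
    split : ∀ x → x ^ f * x ^ (g ∸ f) ≡ x ^ g
    split x = trans (sym (^-distribˡ-+-* x f (g ∸ f))) (cong (x ^_) (m+[n∸m]≡n f≤g))

  Rate-halve : ∀ e → Rate (e + e) → Rate (suc e)
  Rate-halve e r = subst₂ (RichCountBound q) (*-comm (M ^ e) M) (*-comm (suc M ^ e) (suc M))
    (bootstrap 1≤q M 1≤M {M ^ e} {suc M ^ e} (^-monoʳ-≤′ {n = 0} {e} 1≤M z≤n) (^-monoˡ-≤ e (n≤1+n M))
      (subst₂ (RichCountBound q) (^-distribˡ-+-* M e e) (^-distribˡ-+-* (suc M) e e) r))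

  Rate-3 : ∀ f → Rate f → Rate 3
  Rate-3 = <-rec (λ f → Rate f → Rate 3) λ where
    0 _ → Rate-mono {0} {3} z≤n
    1 _ → Rate-mono {1} {3} (s≤s z≤n)
    2 _ → Rate-mono {2} {3} (s≤s (s≤s z≤n))
    3 _ r → r
    f@(suc (suc (suc (suc g)))) rec r → rec (s≤s (s≤s (s≤s (s≤s (⌈n/2⌉≤n g)))))
      (Rate-halve ⌈ f /2⌉ (Rate-mono (n≤⌈n/2⌉+⌈n/2⌉ f) r))

  Rate-initial : Rate (suc (q * M))
  Rate-initial = 1 , λ n → begin
    richCount q n * (M ^ f) ^ n   ≤⟨ *-monoˡ-≤ _ (richCount≤q^n q n) ⟩
    q ^ n * (M ^ f) ^ n           ≡⟨ ^-distribʳ-* q (M ^ f) n ⟨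
    (q * M ^ f) ^ n               ≤⟨ ^-monoˡ-≤ n (<⇒≤ (*^<suc^ M q f ≤-refl)) ⟩
    (suc M ^ f) ^ n               ≡⟨ *-identityˡ _ ⟨
    1 * (suc M ^ f) ^ n           ∎
    where
    open ≤-Reasoning
    f = suc (q * M)

-- With M = 7u + 1 this says (1 + 1/M)^3 < 1 + 1/u.
cube-margin : ∀ u → suc (suc (suc (7 * u)) ^ 3 * u) ≤ suc u * suc (7 * u) ^ 3
cube-margin u = ≤-trans (m≤m+n _ (196 * (u * u * u) + 84 * (u * u) + 14 * u)) (≤-reflexive (identity u))
  where
  identity : ∀ u → let M = suc (7 * u) in
    suc (suc M * (suc M * (suc M * 1)) * u) + (196 * (u * u * u) + 84 * (u * u) + 14 * u) ≡ suc u * (M * (M * (M * 1)))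
  identity = solve-∀

richCount-subexponential : ∀ {q} → 1 ≤ q → ∀ k →
  ∃[ N ] (∀ n → N ≤ n → richCount q n * suc k ^ n < suc (suc k) ^ n)
richCount-subexponential {q} 1≤q k = suc (K * x) , upper
  where
  M = suc (7 * suc k)
  open Descent 1≤q M (s≤s z≤n)
  rate : Rate 3
  rate = Rate-3 (suc (q * M)) Rate-initial
  K = proj₁ rate
  x = suc M ^ 3 * suc k
  upper : ∀ n → suc (K * x) ≤ n → richCount q n * suc k ^ n < suc (suc k) ^ n
  upper n Kx<n = *-cancelʳ-< ((M ^ 3) ^ n) _ _ (begin-strict
    richCount q n * suc k ^ n * (M ^ 3) ^ n ≡⟨ *-assoc (richCount q n) _ _ ⟩
    richCount q n * (suc k ^ n * (M ^ 3) ^ n) ≡⟨ cong (richCount q n *_) (*-comm (suc k ^ n) _) ⟩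
    richCount q n * ((M ^ 3) ^ n * suc k ^ n) ≡⟨ *-assoc (richCount q n) _ _ ⟨
    richCount q n * (M ^ 3) ^ n * suc k ^ n ≤⟨ *-monoˡ-≤ (suc k ^ n) (proj₂ rate n) ⟩
    K * (suc M ^ 3) ^ n * suc k ^ n         ≡⟨ *-assoc K _ _ ⟩
    K * ((suc M ^ 3) ^ n * suc k ^ n)       ≡⟨ cong (K *_) (^-distribʳ-* (suc M ^ 3) (suc k) n) ⟨
    K * x ^ n                               <⟨ *^<suc^ x K n Kx<n ⟩
    suc x ^ n                               ≤⟨ ^-monoˡ-≤ n (cube-margin (suc k)) ⟩
    (suc (suc k) * M ^ 3) ^ n               ≡⟨ ^-distribʳ-* (suc (suc k)) (M ^ 3) n ⟩
    suc (suc k) ^ n * (M ^ 3) ^ n           ∎)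
    where open ≤-Reasoning

module _ {q : ℕ} (a : Fin q) where
  open Palindromes {q}

  replicate-palindrome : ∀ n → IsPalindrome (replicate n a)
  replicate-palindrome zero    = refl
  replicate-palindrome (suc n) = begin
    reverse (a ∷ replicate n a)      ≡⟨ unfold-reverse a (replicate n a) ⟩
    reverse (replicate n a) ++ [ a ] ≡⟨ cong (_++ [ a ]) (replicate-palindrome n) ⟩
    replicate n a ++ [ a ]           ≡⟨ replicate-++-[] n a ⟩
    a ∷ replicate n a                ∎
    where open ≡-Reasoning

  replicate-rich : ∀ n → IsRich (replicate n a)
  replicate-rich zero    = refl
  replicate-rich (suc n) = NewPalPrefix⇒IsRich-∷ (replicate-rich n)
    (([] , ++-identityʳ _) , replicate-palindrome (suc n) , λ f → 1+n≰n (begin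
      suc n                        ≡⟨ length-replicate (suc n) ⟨
      length (replicate (suc n) a) ≤⟨ Factor⇒length≤ f ⟩
      length (replicate n a)       ≡⟨ length-replicate n ⟩
      n                            ∎))
    where open ≤-Reasoning

  richCount-positive : ∀ n → 1 ≤ richCount q n
  richCount-positive n = ∈-length (∈-filter⁺ rich?
    (subst (λ m → replicate n a ∈ words q m) (length-replicate n) (∈-words (replicate n a))) (replicate-rich n))

^<richCount*suc^ : ∀ {q} → 1 ≤ q → ∀ k n → .{{NonZero n}} → k ^ n < richCount q n * suc k ^ n
^<richCount*suc^ {suc q} _ k n = begin-strict
  k ^ n                           <⟨ ^-monoˡ-< n (n<1+n k) ⟩
  suc k ^ n                       ≤⟨ m≤n*m (suc k ^ n) (richCount (suc q) n) {{R≢0}} ⟩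
  richCount (suc q) n * suc k ^ n ∎
  where
  open ≤-Reasoning
  R≢0 : NonZero (richCount (suc q) n)
  R≢0 = >-nonZero (richCount-positive Fin.zero n)

theorem3 : (q : ℕ) → 2 ≤ q → (k : ℕ) →
    ∃[ N ] ((n : ℕ) → N ≤ n →
      (k ^ n < richCount q n * suc k ^ n) × (richCount q n * suc k ^ n < suc (suc k) ^ n))
theorem3 q 2≤q k =
  let 1≤q = <⇒≤ 2≤q
      N , upper = richCount-subexponential 1≤q k
  in suc N , λ n N<n →
       ^<richCount*suc^ 1≤q k n {{>-nonZero (≤-trans (s≤s z≤n) N<n)}} , upper n (≤-trans (n≤1+n N) N<n)
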